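{- Let $R$ be a p.q.-Baer $*$-ring with at least four central projections such that $\Gamma^*_s(R)^c$ is disconnected. Then $\mathrm{gr}(\Gamma^*_s(R)^c)\in\{3,\infty\}$.
   Context: A $*$-ring is a ring $R$ with an involution $x\mapsto x^*$. A projection is an element $e$ with $e^2=e=e^*$; a central projection is a projection in the centre of $R$. For $S\subseteq R$, $r_R(S)=\{x\in R: sx=0\ \forall s\in S\}$. $R$ is a p.q.-Baer $*$-ring if for every $a\in R$, $r_R(aR)=eR$ for some projection $e\in R$. The strong zero-divisor graph $\Gamma^*_s(R)$ is the simple undirected graph with vertex set $\{0\neq a\in R: r_R(aR)\neq\{0\}\}$, distinct vertices $a,b$ adjacent iff $aRb^*=0$. The complement $G^c$ of a simple graph $G$ has the same vertices, distinct vertices adjacent iff not adjacent in $G$. The girth $\mathrm{gr}$ is the length of a shortest cycle, $\infty$ if there is no cycle. -}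

module Defs where

open import Level using (Level; _⊔_) renaming (suc to lsuc)
open import Algebra.Bundles using (Ring)
open import Data.Nat using (ℕ; zero; suc; _<_; _%_)
open import Data.Nat.DivMod using (m%n<n)
open import Data.Fin using (Fin; toℕ; fromℕ<)
open import Data.Product using (Σ; _×_; ∃)
open import Data.Sum using (_⊎_)
open import Data.Empty using (⊥)
open import Relation.Nullary using (¬_)
open import Relation.Binary.PropositionalEquality using (_≡_)
open import Relation.Binary.Construct.Closure.ReflexiveTransitive using (Star)

record StarRing (c ℓ : Level) : Set (lsuc (c ⊔ ℓ)) where
  field
    ring : Ring c ℓ
  open Ring ring public
  infix 10 _⋆
  field
    _⋆     : Carrier → Carrier
    ⋆-cong : ∀ {x y} → x ≈ y → x ⋆ ≈ y ⋆
    ⋆-+    : ∀ x y → (x + y) ⋆ ≈ x ⋆ + y ⋆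
    ⋆-*    : ∀ x y → (x * y) ⋆ ≈ y ⋆ * x ⋆
    ⋆-inv  : ∀ x → (x ⋆) ⋆ ≈ x

module StarRingNotions {c ℓ : Level} (R : StarRing c ℓ) where
  open StarRing R

  InRAnnAR : Carrier → Carrier → Set (c ⊔ ℓ)
  InRAnnAR a x = ∀ r → (a * r) * x ≈ 0#

  InPrincipal : Carrier → Carrier → Set (c ⊔ ℓ)
  InPrincipal e x = Σ Carrier λ y → x ≈ e * y

  IsProjection : Carrier → Set ℓ
  IsProjection e = (e * e ≈ e) × (e ⋆ ≈ e)

  IsCentral : Carrier → Set (c ⊔ ℓ)
  IsCentral e = ∀ x → e * x ≈ x * e

  IsCentralProjection : Carrier → Set (c ⊔ ℓ)
  IsCentralProjection e = IsProjection e × IsCentral e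

  IsPQBaer : Set (c ⊔ ℓ)
  IsPQBaer = ∀ a → Σ Carrier λ e → IsProjection e ×
               (∀ x → (InRAnnAR a x → InPrincipal e x) × (InPrincipal e x → InRAnnAR a x))

  AtLeastFourCentralProjections : Set (c ⊔ ℓ)
  AtLeastFourCentralProjections =
    Σ Carrier λ e₁ → Σ Carrier λ e₂ → Σ Carrier λ e₃ → Σ Carrier λ e₄ →
      IsCentralProjection e₁ × IsCentralProjection e₂ ×
      IsCentralProjection e₃ × IsCentralProjection e₄ ×
      ¬ e₁ ≈ e₂ × ¬ e₁ ≈ e₃ × ¬ e₁ ≈ e₄ × ¬ e₂ ≈ e₃ × ¬ e₂ ≈ e₄ × ¬ e₃ ≈ e₄

  -- vertices of Γ*_s(R): a ≠ 0 with r_R(aR) ≠ {0}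
  IsVertex : Carrier → Set (c ⊔ ℓ)
  IsVertex a = ¬ a ≈ 0# × ¬ (∀ x → InRAnnAR a x → x ≈ 0#)

  AdjΓ : Carrier → Carrier → Set (c ⊔ ℓ)
  AdjΓ a b = ¬ a ≈ b × (∀ r → (a * r) * (b ⋆) ≈ 0#)

  AdjΓc : Carrier → Carrier → Set (c ⊔ ℓ)
  AdjΓc a b = ¬ a ≈ b × ¬ (∀ r → (a * r) * (b ⋆) ≈ 0#)

module GraphNotions {a ℓ p q : Level} (V : Set a) (_≈_ : V → V → Set ℓ)
                    (Vtx : V → Set p) (Adj : V → V → Set q) where

  Vertex : Set (a ⊔ p)
  Vertex = Σ V Vtx

  Step : Vertex → Vertex → Set (ℓ ⊔ q)
  Step u v = (Σ.proj₁ u ≈ Σ.proj₁ v) ⊎ Adj (Σ.proj₁ u) (Σ.proj₁ v)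

  Connected : Set (a ⊔ p ⊔ ℓ ⊔ q)
  Connected = ∀ u v → Star Step u v

  Disconnected : Set (a ⊔ p ⊔ ℓ ⊔ q)
  Disconnected = ¬ Connected

  cnext : ∀ {m} → Fin (suc m) → Fin (suc m)
  cnext {m} i = fromℕ< (m%n<n (suc (toℕ i)) (suc m))

  HasCycle : ℕ → Set (a ⊔ p ⊔ ℓ ⊔ q)
  HasCycle zero = Level.Lift _ ⊥
  HasCycle (suc zero) = Level.Lift _ ⊥
  HasCycle (suc (suc zero)) = Level.Lift _ ⊥
  HasCycle (suc (suc (suc k))) =
    Σ (Fin (suc (suc (suc k))) → V) λ c →
      (∀ i → Vtx (c i)) ×
      (∀ i j → c i ≈ c j → i ≡ j) ×
      (∀ i → Adj (c i) (c (cnext i)))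

data ℕ∞ : Set where
  fin : ℕ → ℕ∞
  ∞   : ℕ∞

module GirthNotions {a ℓ p q : Level} (V : Set a) (_≈_ : V → V → Set ℓ)
                    (Vtx : V → Set p) (Adj : V → V → Set q) where
  open GraphNotions V _≈_ Vtx Adj

  IsGirth : ℕ∞ → Set (a ⊔ p ⊔ ℓ ⊔ q)
  IsGirth (fin n) = HasCycle n × (∀ m → m < n → ¬ HasCycle m)
  IsGirth ∞       = ∀ n → ¬ HasCycle n

module Γc {c ℓ : Level} (R : StarRing c ℓ) where
  open StarRing R using (Carrier; _≈_)
  open StarRingNotions R
  open GraphNotions Carrier _≈_ IsVertex AdjΓc public
  open GirthNotions Carrier _≈_ IsVertex AdjΓc public

module Submission where

-- In a p.q.-Baer *-ring write r(aR) = ann a · R; the projection ann a is central, and so is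
-- supp a = 1 - ann a.  Then aRb⋆ = 0 as soon as supp a · supp b = 0, so for adjacent a, b of the
-- complement graph m = supp a · supp b is nonzero; it is again a vertex (ann a kills it), and
-- m · supp a = m = m · supp b makes m adjacent to both a and b.  Thus a, b, m is a triangle unless
-- m is a or b, and then a neighbour of a (resp. b) on a cycle of length ≥ 4 closes a triangle
-- instead.  So a graph of finite girth has girth 3.

open import Defs
open import Level using (Level; _⊔_; lift)
open import Data.Nat using (suc; s≤s; z≤n)
open import Data.Fin using (Fin)
open import Data.Fin.Patterns using (0F; 1F; 2F; 3F)
open import Data.Product using (_×_; _,_; proj₁; proj₂)
open import Data.Sum using (_⊎_; inj₁; inj₂)
open import Data.Empty using (⊥-elim)
open import Function.Base using (_∘_)
open import Function.Bundles using (_⇔_; mk⇔; module Equivalence)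
open import Function.Construct.Composition using (_⇔-∘_)
open import Relation.Nullary using (¬_)
open import Relation.Binary.PropositionalEquality using (_≡_; refl)
import Algebra.Properties.Ring as RingProperties
import Relation.Binary.Reasoning.Setoid as SetoidReasoning

open Equivalence using (to; from)

module StarRingProperties {c ℓ : Level} (R : StarRing c ℓ) where
  open StarRing R
  open StarRingNotions R
  open RingProperties ring
  open SetoidReasoning setoid

  ⋆-0# : 0# ⋆ ≈ 0#
  ⋆-0# = x+x≈x⇒x≈0 (0# ⋆) (trans (sym (⋆-+ 0# 0#)) (⋆-cong (+-identityˡ 0#)))

  ⋆-1# : 1# ⋆ ≈ 1#
  ⋆-1# = begin
    1# ⋆                ≈⟨ *-identityʳ (1# ⋆) ⟨
    1# ⋆ * 1#           ≈⟨ *-congˡ (⋆-inv 1#) ⟨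
    1# ⋆ * (1# ⋆) ⋆     ≈⟨ ⋆-* (1# ⋆) 1# ⟨
    (1# ⋆ * 1#) ⋆       ≈⟨ ⋆-cong (*-identityʳ (1# ⋆)) ⟩
    (1# ⋆) ⋆            ≈⟨ ⋆-inv 1# ⟩
    1#                  ∎

  ⋆-‿ : ∀ x → (- x) ⋆ ≈ - (x ⋆)
  ⋆-‿ x = +-inverseˡ-unique ((- x) ⋆) (x ⋆) (begin
    (- x) ⋆ + x ⋆       ≈⟨ ⋆-+ (- x) x ⟨
    (- x + x) ⋆         ≈⟨ ⋆-cong (-‿inverseˡ x) ⟩
    0# ⋆                ≈⟨ ⋆-0# ⟩
    0#                  ∎)

  _⟂_ : Carrier → Carrier → Set (c ⊔ ℓ)
  a ⟂ b = InRAnnAR a (b ⋆)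

  ⟂-sym : ∀ {a b} → a ⟂ b → b ⟂ a
  ⟂-sym {a} {b} a⟂b r = begin
    b * r * a ⋆                 ≈⟨ *-assoc b r (a ⋆) ⟩
    b * (r * a ⋆)               ≈⟨ *-cong (⋆-inv b) (*-congʳ (⋆-inv r)) ⟨
    (b ⋆) ⋆ * ((r ⋆) ⋆ * a ⋆)   ≈⟨ *-congˡ (⋆-* a (r ⋆)) ⟨
    (b ⋆) ⋆ * (a * r ⋆) ⋆       ≈⟨ ⋆-* (a * r ⋆) (b ⋆) ⟨
    (a * r ⋆ * b ⋆) ⋆           ≈⟨ ⋆-cong (a⟂b (r ⋆)) ⟩
    0# ⋆                        ≈⟨ ⋆-0# ⟩
    0#                          ∎

  ∈r-congˡ : ∀ {a b x} → a ≈ b → InRAnnAR a x → InRAnnAR b x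
  ∈r-congˡ a≈b x∈r r = trans (*-congʳ (*-congʳ (sym a≈b))) (x∈r r)

  ∈r-*ˡ : ∀ {a x} s → InRAnnAR a x → InRAnnAR (s * a) x
  ∈r-*ˡ {a} {x} s x∈r r = begin
    s * a * r * x       ≈⟨ *-congʳ (*-assoc s a r) ⟩
    s * (a * r) * x     ≈⟨ *-assoc s (a * r) x ⟩
    s * (a * r * x)     ≈⟨ *-congˡ (x∈r r) ⟩
    s * 0#              ≈⟨ zeroʳ s ⟩
    0#                  ∎

  ∈r-*ʳ : ∀ {a x} s → InRAnnAR a x → InRAnnAR (a * s) x
  ∈r-*ʳ {a} s x∈r r = trans (*-congʳ (*-assoc a s r)) (x∈r (s * r))

  ∈r-leftIdeal : ∀ {a x} s → InRAnnAR a x → InRAnnAR a (s * x)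
  ∈r-leftIdeal {a} {x} s x∈r r = begin
    a * r * (s * x)     ≈⟨ *-assoc (a * r) s x ⟨
    a * r * s * x       ≈⟨ *-congʳ (*-assoc a r s) ⟩
    a * (r * s) * x     ≈⟨ x∈r (r * s) ⟩
    0#                  ∎

  central⇒∈r : ∀ {e x} → IsCentral e → e * x ≈ 0# → InRAnnAR e x
  central⇒∈r {e} {x} central ex≈0 r = begin
    e * r * x           ≈⟨ *-congʳ (central r) ⟩
    r * e * x           ≈⟨ *-assoc r e x ⟩
    r * (e * x)         ≈⟨ *-congˡ ex≈0 ⟩
    r * 0#              ≈⟨ zeroʳ r ⟩
    0#                  ∎

  -- A projection e with Re ⊆ eRe is central: applying ⋆ to the hypothesis gives eR ⊆ eRe as well.
  projection-central : ∀ {e} → IsProjection e → (∀ s → s * e ≈ e * s * e) → IsCentral e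
  projection-central {e} (_ , e⋆≈e) Re⊆eRe s = begin
    e * s                   ≈⟨ *-cong e⋆≈e (⋆-inv s) ⟨
    e ⋆ * (s ⋆) ⋆           ≈⟨ ⋆-* (s ⋆) e ⟨
    (s ⋆ * e) ⋆             ≈⟨ ⋆-cong (Re⊆eRe (s ⋆)) ⟩
    (e * s ⋆ * e) ⋆         ≈⟨ ⋆-* (e * s ⋆) e ⟩
    e ⋆ * (e * s ⋆) ⋆       ≈⟨ *-congˡ (⋆-* e (s ⋆)) ⟩
    e ⋆ * ((s ⋆) ⋆ * e ⋆)   ≈⟨ *-cong e⋆≈e (*-cong (⋆-inv s) e⋆≈e) ⟩
    e * (s * e)             ≈⟨ *-assoc e s e ⟨
    e * s * e               ≈⟨ Re⊆eRe s ⟨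
    s * e                   ∎

  infix 10 _ᶜ
  _ᶜ : Carrier → Carrier
  e ᶜ = 1# - e

  x≈e*x⇔eᶜ*x≈0 : ∀ {e x} → (x ≈ e * x) ⇔ (e ᶜ * x ≈ 0#)
  x≈e*x⇔eᶜ*x≈0 {e} {x} = mk⇔
    (λ x≈ex → trans eᶜx≈x-ex (x≈y⇒x∙y⁻¹≈ε x≈ex))
    (λ eᶜx≈0 → x∙y⁻¹≈ε⇒x≈y x (e * x) (trans (sym eᶜx≈x-ex) eᶜx≈0))
    where
    eᶜx≈x-ex : e ᶜ * x ≈ x - e * x
    eᶜx≈x-ex = trans ([y-z]x≈yx-zx x 1# e) (+-congʳ (*-identityˡ x))

  x*e≈0⇒x*eᶜ≈x : ∀ {e x} → x * e ≈ 0# → x * e ᶜ ≈ x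
  x*e≈0⇒x*eᶜ≈x {e} {x} xe≈0 = begin
    x * (1# - e)        ≈⟨ x[y-z]≈xy-xz x 1# e ⟩
    x * 1# - x * e      ≈⟨ +-cong (*-identityʳ x) (-‿cong xe≈0) ⟩
    x - 0#              ≈⟨ +-congˡ -0#≈0# ⟩
    x + 0#              ≈⟨ +-identityʳ x ⟩
    x                   ∎

  ᶜ-projection : ∀ {e} → IsProjection e → IsProjection (e ᶜ)
  ᶜ-projection {e} (ee≈e , e⋆≈e) = idempotent , selfAdjoint
    where
    idempotent : e ᶜ * e ᶜ ≈ e ᶜ
    idempotent = x*e≈0⇒x*eᶜ≈x (to x≈e*x⇔eᶜ*x≈0 (sym ee≈e))
    selfAdjoint : (e ᶜ) ⋆ ≈ e ᶜ
    selfAdjoint = begin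
      (1# - e) ⋆          ≈⟨ ⋆-+ 1# (- e) ⟩
      1# ⋆ + (- e) ⋆      ≈⟨ +-cong ⋆-1# (⋆-‿ e) ⟩
      1# - e ⋆            ≈⟨ +-congˡ (-‿cong e⋆≈e) ⟩
      1# - e              ∎

  ᶜ-central : ∀ {e} → IsCentral e → IsCentral (e ᶜ)
  ᶜ-central {e} central s = begin
    (1# - e) * s        ≈⟨ [y-z]x≈yx-zx s 1# e ⟩
    1# * s - e * s      ≈⟨ +-cong (*-identityˡ s) (-‿cong (central s)) ⟩
    s - s * e           ≈⟨ +-congʳ (*-identityʳ s) ⟨
    s * 1# - s * e      ≈⟨ x[y-z]≈xy-xz s 1# e ⟨
    s * (1# - e)        ∎

module PQBaerProperties {c ℓ : Level} (R : StarRing c ℓ) (pqBaer : StarRingNotions.IsPQBaer R) where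
  open StarRing R
  open StarRingNotions R
  open StarRingProperties R
  open SetoidReasoning setoid

  ann : Carrier → Carrier
  ann a = proj₁ (pqBaer a)

  ann-projection : ∀ a → IsProjection (ann a)
  ann-projection a = proj₁ (proj₂ (pqBaer a))

  ∈r⇔≈ann* : ∀ {a x} → InRAnnAR a x ⇔ (x ≈ ann a * x)
  ∈r⇔≈ann* {a} {x} = mk⇔ fixed (λ x≈ex → proj₂ (r[aR]≡annR x) (x , x≈ex))
    where
    r[aR]≡annR : ∀ x → (InRAnnAR a x → InPrincipal (ann a) x) × (InPrincipal (ann a) x → InRAnnAR a x)
    r[aR]≡annR = proj₂ (proj₂ (pqBaer a))
    fixed : InRAnnAR a x → x ≈ ann a * x
    fixed x∈r = let (y , x≈ey) = proj₁ (r[aR]≡annR x) x∈r in begin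
      x                       ≈⟨ x≈ey ⟩
      ann a * y               ≈⟨ *-congʳ (proj₁ (ann-projection a)) ⟨
      ann a * ann a * y       ≈⟨ *-assoc (ann a) (ann a) y ⟩
      ann a * (ann a * y)     ≈⟨ *-congˡ x≈ey ⟨
      ann a * x               ∎

  ann∈r : ∀ a → InRAnnAR a (ann a)
  ann∈r a = from ∈r⇔≈ann* (sym (proj₁ (ann-projection a)))

  ann-central : ∀ a → IsCentral (ann a)
  ann-central a = projection-central (ann-projection a) λ s →
    trans (to ∈r⇔≈ann* (∈r-leftIdeal s (ann∈r a))) (sym (*-assoc (ann a) s (ann a)))

  supp : Carrier → Carrier
  supp a = ann a ᶜ

  supp-projection : ∀ a → IsProjection (supp a)
  supp-projection a = ᶜ-projection (ann-projection a)

  supp-central : ∀ a → IsCentral (supp a)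
  supp-central a = ᶜ-central (ann-central a)

  ∈r⇔supp*≈0 : ∀ {a x} → InRAnnAR a x ⇔ (supp a * x ≈ 0#)
  ∈r⇔supp*≈0 = x≈e*x⇔eᶜ*x≈0 ⇔-∘ ∈r⇔≈ann*

  supp*ann≈0 : ∀ a → supp a * ann a ≈ 0#
  supp*ann≈0 a = to x≈e*x⇔eᶜ*x≈0 (sym (proj₁ (ann-projection a)))

  *supp≈id : ∀ a → a * supp a ≈ a
  *supp≈id a = x*e≈0⇒x*eᶜ≈x (trans (*-congʳ (sym (*-identityʳ a))) (ann∈r a 1#))

  ⋆≈supp*⋆ : ∀ a → a ⋆ ≈ supp a * a ⋆
  ⋆≈supp*⋆ a = begin
    a ⋆                 ≈⟨ ⋆-cong (*supp≈id a) ⟨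
    (a * supp a) ⋆      ≈⟨ ⋆-* a (supp a) ⟩
    supp a ⋆ * a ⋆      ≈⟨ *-congʳ (proj₂ (supp-projection a)) ⟩
    supp a * a ⋆        ∎

  supp-⟂ : ∀ {a x} → a ⟂ x → supp a ⟂ x
  supp-⟂ {a} a⟂x = central⇒∈r (supp-central a) (to ∈r⇔supp*≈0 a⟂x)

  ⟂⇒*supp≈0 : ∀ {a b} → b ⟂ a → b * supp a ≈ 0#
  ⟂⇒*supp≈0 {a} {b} b⟂a = begin
    b * supp a              ≈⟨ *-cong (⋆-inv b) (proj₂ (supp-projection a)) ⟨
    (b ⋆) ⋆ * supp a ⋆      ≈⟨ ⋆-* (supp a) (b ⋆) ⟨
    (supp a * b ⋆) ⋆        ≈⟨ ⋆-cong (to ∈r⇔supp*≈0 (⟂-sym b⟂a)) ⟩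
    0# ⋆                    ≈⟨ ⋆-0# ⟩
    0#                      ∎

  supp*supp≈0⇒⟂ : ∀ {a b} → supp a * supp b ≈ 0# → a ⟂ b
  supp*supp≈0⇒⟂ {a} {b} orthogonal = from ∈r⇔supp*≈0 (begin
    supp a * b ⋆                ≈⟨ *-congˡ (⋆≈supp*⋆ b) ⟩
    supp a * (supp b * b ⋆)     ≈⟨ *-assoc (supp a) (supp b) (b ⋆) ⟨
    supp a * supp b * b ⋆       ≈⟨ *-congʳ orthogonal ⟩
    0# * b ⋆                    ≈⟨ zeroˡ (b ⋆) ⟩
    0#                          ∎)

  ann≉0 : ∀ {a} → IsVertex a → ¬ ann a ≈ 0#
  ann≉0 (_ , nonfaithful) ann≈0 =
    nonfaithful λ x x∈r → trans (to ∈r⇔≈ann* x∈r) (trans (*-congʳ ann≈0) (zeroˡ x))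

  module _ {a b : Carrier} where

    meet*suppˡ : supp a * supp b * supp a ≈ supp a * supp b
    meet*suppˡ = begin
      supp a * supp b * supp a      ≈⟨ *-assoc (supp a) (supp b) (supp a) ⟩
      supp a * (supp b * supp a)    ≈⟨ *-congˡ (supp-central b (supp a)) ⟩
      supp a * (supp a * supp b)    ≈⟨ *-assoc (supp a) (supp a) (supp b) ⟨
      supp a * supp a * supp b      ≈⟨ *-congʳ (proj₁ (supp-projection a)) ⟩
      supp a * supp b               ∎

    meet*suppʳ : supp a * supp b * supp b ≈ supp a * supp b
    meet*suppʳ = trans (*-assoc (supp a) (supp b) (supp b)) (*-congˡ (proj₁ (supp-projection b)))

    meet-vertex : IsVertex a → ¬ a ⟂ b → IsVertex (supp a * supp b)
    meet-vertex a-vertex a≭b = a≭b ∘ supp*supp≈0⇒⟂ , λ faithful →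
      ann≉0 a-vertex (faithful (ann a) (∈r-*ʳ (supp b) (central⇒∈r (supp-central a) (supp*ann≈0 a))))

    ¬meet⟂ˡ : ¬ a ⟂ b → ¬ (supp a * supp b) ⟂ a
    ¬meet⟂ˡ a≭b m⟂a = a≭b (supp*supp≈0⇒⟂ (trans (sym meet*suppˡ) (⟂⇒*supp≈0 m⟂a)))

    ¬⟂meetʳ : ¬ a ⟂ b → ¬ b ⟂ (supp a * supp b)
    ¬⟂meetʳ a≭b b⟂m = a≭b (supp*supp≈0⇒⟂ (trans (sym meet*suppʳ) (⟂⇒*supp≈0 (⟂-sym b⟂m))))

module Girth {c ℓ : Level} (R : StarRing c ℓ) (pqBaer : StarRingNotions.IsPQBaer R) where
  open StarRing R using (Carrier; _≈_; _*_; sym)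
  open StarRingNotions R
  open StarRingProperties R
  open PQBaerProperties R pqBaer
  open Γc R

  triangle : ∀ {x y z} → IsVertex x → IsVertex y → IsVertex z →
             AdjΓc x y → AdjΓc y z → AdjΓc z x → HasCycle 3
  triangle {x} {y} {z} x-vertex y-vertex z-vertex x—y y—z z—x = corner , vertex , injective , adjacent
    where
    corner : Fin 3 → Carrier
    corner 0F = x
    corner 1F = y
    corner 2F = z
    vertex : ∀ i → IsVertex (corner i)
    vertex 0F = x-vertex
    vertex 1F = y-vertex
    vertex 2F = z-vertex
    adjacent : ∀ i → AdjΓc (corner i) (corner (cnext i))
    adjacent 0F = x—y
    adjacent 1F = y—z
    adjacent 2F = z—x
    injective : ∀ i j → corner i ≈ corner j → i ≡ j
    injective 0F 0F _ = refl
    injective 1F 1F _ = refl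
    injective 2F 2F _ = refl
    injective 0F 1F x≈y = ⊥-elim (proj₁ x—y x≈y)
    injective 1F 2F y≈z = ⊥-elim (proj₁ y—z y≈z)
    injective 2F 0F z≈x = ⊥-elim (proj₁ z—x z≈x)
    injective 1F 0F y≈x = ⊥-elim (proj₁ x—y (sym y≈x))
    injective 2F 1F z≈y = ⊥-elim (proj₁ y—z (sym z≈y))
    injective 0F 2F x≈z = ⊥-elim (proj₁ z—x (sym x≈z))

  path₃⇒¬¬triangle : ∀ {x a b y} → IsVertex x → IsVertex a → IsVertex b → IsVertex y →
                     AdjΓc x a → AdjΓc a b → AdjΓc b y → ¬ x ≈ b → ¬ a ≈ y → ¬ ¬ HasCycle 3
  path₃⇒¬¬triangle {x} {a} {b} {y} x-vertex a-vertex b-vertex y-vertex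
                   x—a@(_ , x≭a) a—b@(_ , a≭b) b—y@(_ , b≭y) x≉b a≉y triangle-free =
    triangle-free (triangle a-vertex b-vertex (meet-vertex a-vertex a≭b)
                            a—b (b≉m , ¬⟂meetʳ a≭b) (m≉a , ¬meet⟂ˡ a≭b))
    where
    m : Carrier
    m = supp a * supp b
    m≉a : ¬ m ≈ a
    m≉a m≈a = triangle-free (triangle x-vertex a-vertex b-vertex x—a a—b (x≉b ∘ sym , b≭x))
      where
      b≭x : ¬ b ⟂ x
      b≭x b⟂x = x≭a (⟂-sym (∈r-congˡ m≈a (∈r-*ˡ (supp a) (supp-⟂ b⟂x))))
    b≉m : ¬ b ≈ m
    b≉m b≈m = triangle-free (triangle a-vertex b-vertex y-vertex a—b b—y (a≉y ∘ sym , y≭a))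
      where
      y≭a : ¬ y ⟂ a
      y≭a y⟂a = b≭y (∈r-congˡ (sym b≈m) (∈r-*ʳ (supp b) (supp-⟂ (⟂-sym y⟂a))))

  longCycle⇒¬¬triangle : ∀ k → HasCycle (suc (suc (suc (suc k)))) → ¬ ¬ HasCycle 3
  longCycle⇒¬¬triangle k (_ , vertex , injective , adjacent) =
    path₃⇒¬¬triangle (vertex 0F) (vertex 1F) (vertex 2F) (vertex 3F)
                     (adjacent 0F) (adjacent 1F) (adjacent 2F)
                     (λ c₀≈c₂ → 0F≢2F (injective 0F 2F c₀≈c₂))
                     (λ c₁≈c₃ → 1F≢3F (injective 1F 3F c₁≈c₃))
    where
    0F≢2F : ¬ 0F ≡ 2F
    0F≢2F ()
    1F≢3F : ¬ 1F ≡ 3F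
    1F≢3F ()

proposition4p9 : {c ℓ : Level} (R : StarRing c ℓ) →
    StarRingNotions.IsPQBaer R →
    StarRingNotions.AtLeastFourCentralProjections R →
    Γc.Disconnected R →
    (g : ℕ∞) → Γc.IsGirth R g → (g ≡ fin 3) ⊎ (g ≡ ∞)
proposition4p9 _ _ _ _ ∞ _ = inj₂ refl
proposition4p9 _ _ _ _ (fin 0) (lift () , _)
proposition4p9 _ _ _ _ (fin 1) (lift () , _)
proposition4p9 _ _ _ _ (fin 2) (lift () , _)
proposition4p9 _ _ _ _ (fin 3) _ = inj₁ refl
proposition4p9 R pqBaer _ _ (fin (suc (suc (suc (suc k))))) (cycle , shortest) =
  ⊥-elim (Girth.longCycle⇒¬¬triangle R pqBaer k cycle (shortest 3 (s≤s (s≤s (s≤s (s≤s z≤n))))))
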